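{- Let $f:\widetilde G\to G$ be a homotopy covering map with $\widetilde G$ connected, let $v$ be a vertex of $G$ and $\tilde v\in f^{ -1}(v)$, and let $\tilde\rho:U_vG\to\widetilde G$ be the unique graph morphism with $f\circ\tilde\rho=\rho$ and $\tilde\rho([v])=\tilde v$. Let $S=\{s\in D(G): \tilde\rho\circ s=\tilde\rho\}$. Then $S$ is a subgroup of $D(G)$ and $U_vG/S\cong\widetilde G$.
   Context: All graphs are undirected, have no multiple edges, may have loops, are connected, and are not a single isolated vertex. A walk is a sequence $(v_0\cdots v_n)$ with $v_i\sim v_{i+1}$; $N_2(v)$ is the set of walks of length 2 from $v$. A homotopy covering map is a morphism $f:\widetilde G\to G$ such that for each vertex $\tilde v$, applying $f$ gives a bijection $N_2(\tilde v)\to N_2(f(\tilde v))$ respecting endpoints (two walks in $N_2(\tilde v)$ end at the same vertex iff their images do). A prune of a walk with $v_i=v_{i+2}$ replaces $v_iv_{i+1}v_i$ by $v_i$; a spider move on $(v_0\cdots v_n)$ replaces one $v_i$, $0<i<n$, by $v_i'$ with $v_{i-1}\sim v_i'\sim v_{i+1}$; walks are equivalent if connected by finitely many prunes, inverse prunes and spider moves. $\Pi(G)$ is the groupoid of vertices and equivalence classes of walks under concatenation ($\alpha*\beta$ = $\alpha$ then $\beta$); $\Pi_v(G)$ is the set of arrows with source $v$. The universal homotopy cover $U_vG$ has vertices the arrows of $\Pi_v(G)$, with $\alpha\sim\beta$ iff $\beta=\alpha*[(wx)]$ for an edge $w\sim x$, $w$ the target of $\alpha$; $\rho:U_vG\to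 G$ sends an arrow to its target; $[v]$ is the class of the length-0 walk $(v)$. $D(G)$ is the group of graph automorphisms $\varphi$ of $U_vG$ with $\rho\circ\varphi=\rho$. For $S\le D(G)$, $U_vG/S$ is the graph of $S$-orbits of vertices, two orbits adjacent iff they have adjacent representatives. -}

module Defs where

open import Level using (0ℓ)
open import Data.Product using (Σ; Σ-syntax; _×_; _,_; proj₁; proj₂)
open import Relation.Binary.PropositionalEquality using (_≡_; refl; sym; trans; cong)
open import Relation.Binary.Construct.Closure.Equivalence as EqC using (EqClosure)

data Walk {V : Set} (E : V → V → Set) : V → V → Set where
  [_]  : (x : V) → Walk E x x
  cons : (x : V) {y z : V} → E x y → Walk E y z → Walk E x z

-- Graphs: undirected (symmetric adjacency), no multiple edges (adjacency is
-- proof-irrelevant), loops allowed, connected, not a single isolated vertex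
-- (there is at least one edge; with connectedness this says exactly that the
-- graph is non-empty and not a single vertex without loop).

record Graph : Set₁ where
  field
    V         : Set
    E         : V → V → Set
    E-sym     : ∀ {x y} → E x y → E y x
    E-prop    : ∀ {x y} (p q : E x y) → p ≡ q
    connected : ∀ x y → Walk E x y
    has-edge  : Σ[ x ∈ V ] Σ[ y ∈ V ] E x y

open Graph public

record Morphism (H G : Graph) : Set where
  field
    fun : V H → V G
    hom : ∀ {x y} → E H x y → E G (fun x) (fun y)

open Morphism public

N₂ : (G : Graph) → V G → Set
N₂ G x = Σ[ a ∈ V G ] Σ[ b ∈ V G ] (E G x a × E G a b)

endpoint : (G : Graph) {x : V G} → N₂ G x → V G
endpoint G (a , b , _) = b

N₂-map : {H G : Graph} (f : Morphism H G) (x : V H) → N₂ H x → N₂ G (fun f x)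
N₂-map f x (a , b , e₁ , e₂) = fun f a , fun f b , hom f e₁ , hom f e₂

record IsHomotopyCovering {H G : Graph} (f : Morphism H G) : Set where
  field
    N₂-injective  : ∀ x (p q : N₂ H x) → N₂-map f x p ≡ N₂-map f x q → p ≡ q
    N₂-surjective : ∀ x (r : N₂ G (fun f x)) → Σ[ p ∈ N₂ H x ] N₂-map f x p ≡ r
    N₂-endpoints  : ∀ x (p q : N₂ H x) →
                    (endpoint H p ≡ endpoint H q → endpoint G (N₂-map f x p) ≡ endpoint G (N₂-map f x q))
                  × (endpoint G (N₂-map f x p) ≡ endpoint G (N₂-map f x q) → endpoint H p ≡ endpoint H q)

module _ (G : Graph) where

  Walk′ : V G → V G → Set
  Walk′ = Walk (E G)

  _++ʷ_ : ∀ {x y z} → Walk′ x y → Walk′ y z → Walk′ x z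
  [ _ ] ++ʷ q = q
  cons x e p ++ʷ q = cons x e (p ++ʷ q)

  edge : ∀ {w x} → E G w x → Walk′ w x
  edge {w} {x} e = cons w e [ x ]

  data Step : ∀ {x y} → Walk′ x y → Walk′ x y → Set where
    prune  : ∀ {x y z} (e : E G x y) (e′ : E G y x) (w : Walk′ x z) →
             Step (cons x e (cons y e′ w)) w
    spider : ∀ {x y y′ z t} (e₁ : E G x y) (e₂ : E G y z)
             (e₁′ : E G x y′) (e₂′ : E G y′ z) (rest : Walk′ z t) →
             Step (cons x e₁ (cons y e₂ rest)) (cons x e₁′ (cons y′ e₂′ rest))
    there  : ∀ {x y z} (e : E G x y) {p q : Walk′ y z} →
             Step p q → Step (cons x e p) (cons x e q)

  _≃ʷ_ : ∀ {x y} → Walk′ x y → Walk′ x y → Set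
  _≃ʷ_ {x} {y} = EqClosure (Step {x} {y})

  -- Arrows of Π_v(G): walks from v (with their target), up to ≃ʷ.
  -- The quotient is represented as a setoid.

  Arr : V G → Set
  Arr v = Σ[ w ∈ V G ] Walk′ v w

  data _≈ᴬ_ {v : V G} : Arr v → Arr v → Set where
    mk : ∀ {w} {p q : Walk′ v w} → p ≃ʷ q → (w , p) ≈ᴬ (w , q)

  ≈ᴬ-refl : ∀ {v} {a : Arr v} → a ≈ᴬ a
  ≈ᴬ-refl {a = _ , p} = mk (EqC.reflexive (Step))

  ≈ᴬ-sym : ∀ {v} {a b : Arr v} → a ≈ᴬ b → b ≈ᴬ a
  ≈ᴬ-sym (mk p) = mk (EqC.symmetric Step p)

  ≈ᴬ-trans : ∀ {v} {a b c : Arr v} → a ≈ᴬ b → b ≈ᴬ c → a ≈ᴬ c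
  ≈ᴬ-trans (mk p) (mk q) = mk (EqC.transitive Step p q)

  ≈ᴬ⇒ρ≡ : ∀ {v} {a b : Arr v} → a ≈ᴬ b → proj₁ a ≡ proj₁ b
  ≈ᴬ⇒ρ≡ (mk _) = refl

  base : (v : V G) → Arr v
  base v = v , [ v ]

  ρ : ∀ {v} → Arr v → V G
  ρ = proj₁

  -- adjacency in the universal homotopy cover U_vG:
  -- α ∼ β iff β = α * [(w x)] for an edge w ∼ x, w the target of α
  UAdj : ∀ {v} → Arr v → Arr v → Set
  UAdj (w , p) (x , q) = Σ[ e ∈ E G w x ] ((x , (p ++ʷ edge e)) ≈ᴬ (x , q))

  -- D(G): automorphisms φ of U_vG (maps on the setoid of arrows, bijective,
  -- preserving and reflecting adjacency) with ρ ∘ φ = ρ.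

  record Deck (v : V G) : Set where
    field
      fwd       : Arr v → Arr v
      bwd       : Arr v → Arr v
      fwd-cong  : ∀ {a b} → a ≈ᴬ b → fwd a ≈ᴬ fwd b
      bwd-cong  : ∀ {a b} → a ≈ᴬ b → bwd a ≈ᴬ bwd b
      bwd-fwd   : ∀ a → bwd (fwd a) ≈ᴬ a
      fwd-bwd   : ∀ a → fwd (bwd a) ≈ᴬ a
      fwd-adj   : ∀ {a b} → UAdj a b → UAdj (fwd a) (fwd b)
      fwd-adj⁻  : ∀ {a b} → UAdj (fwd a) (fwd b) → UAdj a b
      bwd-adj   : ∀ {a b} → UAdj a b → UAdj (bwd a) (bwd b)
      bwd-adj⁻  : ∀ {a b} → UAdj (bwd a) (bwd b) → UAdj a b
      over      : ∀ a → ρ (fwd a) ≡ ρ a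

  open Deck public

  idᴰ : ∀ {v} → Deck v
  idᴰ = record
    { fwd = λ a → a ; bwd = λ a → a
    ; fwd-cong = λ p → p ; bwd-cong = λ p → p
    ; bwd-fwd = λ _ → ≈ᴬ-refl ; fwd-bwd = λ _ → ≈ᴬ-refl
    ; fwd-adj = λ p → p ; fwd-adj⁻ = λ p → p
    ; bwd-adj = λ p → p ; bwd-adj⁻ = λ p → p
    ; over = λ _ → refl }

  _∘ᴰ_ : ∀ {v} → Deck v → Deck v → Deck v
  s ∘ᴰ t = record
    { fwd = λ a → fwd s (fwd t a)
    ; bwd = λ a → bwd t (bwd s a)
    ; fwd-cong = λ p → fwd-cong s (fwd-cong t p)
    ; bwd-cong = λ p → bwd-cong t (bwd-cong s p)
    ; bwd-fwd = λ a → ≈ᴬ-trans (bwd-cong t (bwd-fwd s (fwd t a))) (bwd-fwd t a)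
    ; fwd-bwd = λ a → ≈ᴬ-trans (fwd-cong s (fwd-bwd t (bwd s a))) (fwd-bwd s a)
    ; fwd-adj = λ p → fwd-adj s (fwd-adj t p)
    ; fwd-adj⁻ = λ p → fwd-adj⁻ t (fwd-adj⁻ s p)
    ; bwd-adj = λ p → bwd-adj t (bwd-adj s p)
    ; bwd-adj⁻ = λ p → bwd-adj⁻ s (bwd-adj⁻ t p)
    ; over = λ a → trans (over s (fwd t a)) (over t a) }

  _⁻¹ᴰ : ∀ {v} → Deck v → Deck v
  s ⁻¹ᴰ = record
    { fwd = bwd s ; bwd = fwd s
    ; fwd-cong = bwd-cong s ; bwd-cong = fwd-cong s
    ; bwd-fwd = fwd-bwd s ; fwd-bwd = bwd-fwd s
    ; fwd-adj = bwd-adj s ; fwd-adj⁻ = bwd-adj⁻ s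
    ; bwd-adj = fwd-adj s ; bwd-adj⁻ = fwd-adj⁻ s
    ; over = λ a → sym (trans (sym (≈ᴬ⇒ρ≡ (fwd-bwd s a))) (over s (bwd s a))) }

module _ (G : Graph) {v : V G} where

  IsSubgroup : (Deck G v → Set) → Set
  IsSubgroup P = P (idᴰ G)
               × (∀ s t → P s → P t → P (_∘ᴰ_ G s t))
               × (∀ s → P s → P (_⁻¹ᴰ G s))

  SameOrbit : (Deck G v → Set) → Arr G v → Arr G v → Set
  SameOrbit P a b = Σ[ s ∈ Deck G v ] (P s × _≈ᴬ_ G (fwd s a) b)

  OrbitAdj : (Deck G v → Set) → Arr G v → Arr G v → Set
  OrbitAdj P a b = Σ[ a′ ∈ Arr G v ] Σ[ b′ ∈ Arr G v ]
                   (SameOrbit P a a′ × SameOrbit P b b′ × UAdj G a′ b′)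

  -- graph isomorphism U_vG/S ≅ H, given by a map on representatives that is
  -- well defined on orbits, injective on orbits, surjective, and such that
  -- orbits are adjacent iff their images are adjacent.
  QuotientIso : (Deck G v → Set) → Graph → Set
  QuotientIso P H = Σ[ φ ∈ (Arr G v → V H) ]
      (∀ a b → SameOrbit P a b → φ a ≡ φ b)
    × (∀ a b → φ a ≡ φ b → SameOrbit P a b)
    × (∀ x → Σ[ a ∈ Arr G v ] φ a ≡ x)
    × (∀ a b → OrbitAdj P a b → E H (φ a) (φ b))
    × (∀ a b → E H (φ a) (φ b) → OrbitAdj P a b)

-- Two arrows of Π_v(G) with the same image under ρ̃ differ by a loop at v:
-- if ρ̃ (w , p) = ρ̃ (w , q), then prepending the loop q * p⁻¹ is a deck
-- transformation carrying p to q, and it fixes ρ̃ because a homotopy covering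
-- map is injective on neighbourhoods, so ρ̃ (α * r) is determined by ρ̃ α and
-- the walk r. Surjectivity comes from lifting a walk from ṽ edge by edge,
-- and adjacency of ρ̃-images lifts to adjacency in U_vG in the same way.
module Submission where

open import Defs
open import Data.Product using (_×_; proj₁; _,_; Σ-syntax)
open import Relation.Binary.PropositionalEquality
  using (_≡_; refl; sym; trans; cong; subst; subst₂)
open import Level using (0ℓ)
open import Relation.Binary.Bundles using (Setoid)
import Relation.Binary.Construct.Closure.Equivalence as EqC
import Relation.Binary.Reasoning.Setoid as SetoidReasoning

module WalkEquivalence (G : Graph) where

  _++_ : ∀ {x y z} → Walk′ G x y → Walk′ G y z → Walk′ G x z
  _++_ = _++ʷ_ G

  _≃_ : ∀ {x y} → Walk′ G x y → Walk′ G x y → Set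
  _≃_ = _≃ʷ_ G

  infixr 5 _++_
  infix 4 _≃_

  ++-assoc : ∀ {x y z u} (p : Walk′ G x y) (q : Walk′ G y z) (r : Walk′ G z u) →
             (p ++ q) ++ r ≡ p ++ q ++ r
  ++-assoc [ _ ] q r = refl
  ++-assoc (cons x e p) q r = cong (cons x e) (++-assoc p q r)

  ++-identityʳ : ∀ {x y} (p : Walk′ G x y) → p ++ [ y ] ≡ p
  ++-identityʳ [ _ ] = refl
  ++-identityʳ (cons x e p) = cong (cons x e) (++-identityʳ p)

  ≃-setoid : V G → V G → Setoid 0ℓ 0ℓ
  ≃-setoid x y = EqC.setoid (Step G {x} {y})

  ≃-sym : ∀ {x y} {p q : Walk′ G x y} → p ≃ q → q ≃ p
  ≃-sym = EqC.symmetric (Step G)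

  ≃-trans : ∀ {x y} {p q r : Walk′ G x y} → p ≃ q → q ≃ r → p ≃ r
  ≃-trans = EqC.transitive (Step G)

  ≡⇒≃ : ∀ {x y} {p q : Walk′ G x y} → p ≡ q → p ≃ q
  ≡⇒≃ refl = EqC.reflexive (Step G)

  Step-++ˡ : ∀ {x y z} (c : Walk′ G x y) {p q : Walk′ G y z} →
             Step G p q → Step G (c ++ p) (c ++ q)
  Step-++ˡ [ _ ] s = s
  Step-++ˡ (cons x e c) s = there e (Step-++ˡ c s)

  Step-++ʳ : ∀ {x y z} (r : Walk′ G y z) {p q : Walk′ G x y} →
             Step G p q → Step G (p ++ r) (q ++ r)
  Step-++ʳ r (prune e e′ w) = prune e e′ (w ++ r)
  Step-++ʳ r (spider e₁ e₂ e₁′ e₂′ rest) = spider e₁ e₂ e₁′ e₂′ (rest ++ r)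
  Step-++ʳ r (there e s) = there e (Step-++ʳ r s)

  ≃-++ˡ : ∀ {x y z} (c : Walk′ G x y) {p q : Walk′ G y z} → p ≃ q → c ++ p ≃ c ++ q
  ≃-++ˡ c = EqC.gmap (c ++_) (Step-++ˡ c)

  ≃-++ʳ : ∀ {x y z} (r : Walk′ G y z) {p q : Walk′ G x y} → p ≃ q → p ++ r ≃ q ++ r
  ≃-++ʳ r = EqC.gmap (_++ r) (Step-++ʳ r)

  reverse : ∀ {x y} → Walk′ G x y → Walk′ G y x
  reverse [ x ] = [ x ]
  reverse (cons x e p) = reverse p ++ edge G (E-sym G e)

  ++-reverseʳ : ∀ {x y} (p : Walk′ G x y) → p ++ reverse p ≃ [ x ]
  ++-reverseʳ [ x ] = EqC.reflexive (Step G)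
  ++-reverseʳ (cons x e p) = begin
    cons x e (p ++ reverse p ++ edge G e⁻¹)   ≡⟨ cong (cons x e) (++-assoc p (reverse p) _) ⟨
    cons x e ((p ++ reverse p) ++ edge G e⁻¹) ≈⟨ EqC.gmap (cons x e) (there e)
                                                  (≃-++ʳ (edge G e⁻¹) (++-reverseʳ p)) ⟩
    cons x e (edge G e⁻¹)                     ≈⟨ EqC.return (prune e e⁻¹ [ x ]) ⟩
    [ x ]                                     ∎
    where
    open SetoidReasoning (≃-setoid x x)
    e⁻¹ = E-sym G e

  ++-reverseˡ : ∀ {x y} (p : Walk′ G x y) → reverse p ++ p ≃ [ y ]
  ++-reverseˡ [ x ] = EqC.reflexive (Step G)
  ++-reverseˡ {x} {y} (cons .x {z} e p) = begin
    (reverse p ++ edge G e⁻¹) ++ cons x e p ≡⟨ ++-assoc (reverse p) (edge G e⁻¹) (cons x e p) ⟩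
    reverse p ++ cons z e⁻¹ (cons x e p)    ≈⟨ ≃-++ˡ (reverse p) (EqC.return (prune e⁻¹ e p)) ⟩
    reverse p ++ p                          ≈⟨ ++-reverseˡ p ⟩
    [ y ]                                   ∎
    where
    open SetoidReasoning (≃-setoid y y)
    e⁻¹ = E-sym G e

  cancel-prefix : ∀ {x y z} (c′ : Walk′ G y x) (c : Walk′ G x y) → c′ ++ c ≃ [ y ] →
                  (p : Walk′ G y z) → c′ ++ c ++ p ≃ p
  cancel-prefix c′ c inv p =
    ≃-trans (≡⇒≃ (sym (++-assoc c′ c p))) (≃-++ʳ p inv)

  ≃-cancelˡ : ∀ {x y z} (c′ : Walk′ G y x) (c : Walk′ G x y) → c′ ++ c ≃ [ y ] →
              {p q : Walk′ G y z} → c ++ p ≃ c ++ q → p ≃ q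
  ≃-cancelˡ c′ c inv {p} {q} eq =
    ≃-trans (≃-sym (cancel-prefix c′ c inv p)) (≃-trans (≃-++ˡ c′ eq) (cancel-prefix c′ c inv q))

module LoopDeck (G : Graph) {v : V G} where

  open WalkEquivalence G

  prepend : Walk′ G v v → Arr G v → Arr G v
  prepend c (w , p) = w , c ++ p

  prepend-cong : ∀ c {a b} → _≈ᴬ_ G a b → _≈ᴬ_ G (prepend c a) (prepend c b)
  prepend-cong c (mk r) = mk (≃-++ˡ c r)

  prepend-cancel : ∀ c′ c → c′ ++ c ≃ [ v ] → ∀ a → _≈ᴬ_ G (prepend c′ (prepend c a)) a
  prepend-cancel c′ c inv (w , p) = mk (cancel-prefix c′ c inv p)

  prepend-adj : ∀ c {a b} → UAdj G a b → UAdj G (prepend c a) (prepend c b)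
  prepend-adj c {_ , p} (e , mk r) = e , mk (≃-trans (≡⇒≃ (++-assoc c p (edge G e))) (≃-++ˡ c r))

  prepend-adj⁻ : ∀ c′ c → c′ ++ c ≃ [ v ] →
                 ∀ {a b} → UAdj G (prepend c a) (prepend c b) → UAdj G a b
  prepend-adj⁻ c′ c inv {_ , p} (e , mk r) =
    e , mk (≃-cancelˡ c′ c inv (≃-trans (≡⇒≃ (sym (++-assoc c p (edge G e)))) r))

  loopDeck : Walk′ G v v → Deck G v
  loopDeck c = record
    { fwd = prepend c
    ; bwd = prepend (reverse c)
    ; fwd-cong = prepend-cong c
    ; bwd-cong = prepend-cong (reverse c)
    ; bwd-fwd = prepend-cancel (reverse c) c (++-reverseˡ c)
    ; fwd-bwd = prepend-cancel c (reverse c) (++-reverseʳ c)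
    ; fwd-adj = prepend-adj c
    ; fwd-adj⁻ = prepend-adj⁻ (reverse c) c (++-reverseˡ c)
    ; bwd-adj = prepend-adj (reverse c)
    ; bwd-adj⁻ = prepend-adj⁻ c (reverse c) (++-reverseʳ c)
    ; over = λ _ → refl
    }

N₂-≡ : (G : Graph) {x a a′ b : V G} → a ≡ a′ →
       (e₁ : E G x a) (e₁′ : E G x a′) (e₂ : E G a b) (e₂′ : E G a′ b) →
       _≡_ {A = N₂ G x} (a , b , e₁ , e₂) (a′ , b , e₁′ , e₂′)
N₂-≡ G refl e₁ e₁′ e₂ e₂′ with E-prop G e₁ e₁′ | E-prop G e₂ e₂′
... | refl | refl = refl

-- Compare the back-and-forth walks (y z y) and (y z′ y) in N₂(y).
covering-neighbour-injective : {G̃ G : Graph} (f : Morphism G̃ G) → IsHomotopyCovering f →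
  ∀ {y z z′} → E G̃ y z → E G̃ y z′ → fun f z ≡ fun f z′ → z ≡ z′
covering-neighbour-injective {G̃} {G} f hc {y} {z} {z′} e e′ fz≡fz′ =
  cong proj₁ (IsHomotopyCovering.N₂-injective hc y
    (z , y , e , E-sym G̃ e) (z′ , y , e′ , E-sym G̃ e′)
    (N₂-≡ G fz≡fz′ (hom f e) (hom f e′) (hom f (E-sym G̃ e)) (hom f (E-sym G̃ e′))))

module Stabiliser (G : Graph) {v : V G} {X : Set}
                  (φ : Arr G v → X) (φ-cong : ∀ {a b} → _≈ᴬ_ G a b → φ a ≡ φ b) where

  Fixes : Deck G v → Set
  Fixes s = ∀ a → φ (fwd s a) ≡ φ a

  fixes-isSubgroup : IsSubgroup G Fixes
  fixes-isSubgroup = fixes-id , fixes-∘ , fixes-⁻¹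
    where
    fixes-id : Fixes (idᴰ G)
    fixes-id _ = refl

    fixes-∘ : ∀ s t → Fixes s → Fixes t → Fixes (_∘ᴰ_ G s t)
    fixes-∘ s t fs ft a = trans (fs (fwd t a)) (ft a)

    fixes-⁻¹ : ∀ s → Fixes s → Fixes (_⁻¹ᴰ G s)
    fixes-⁻¹ s fs a = trans (sym (fs (bwd s a))) (φ-cong (fwd-bwd s a))

  sameOrbit⇒≡ : ∀ a b → SameOrbit G Fixes a b → φ a ≡ φ b
  sameOrbit⇒≡ a b (s , fs , sa≈b) = trans (sym (fs a)) (φ-cong sa≈b)

module Lifting (G G̃ : Graph) (f : Morphism G̃ G) (hc : IsHomotopyCovering f) {v : V G}
               (ρ̃ : Arr G v → V G̃)
               (ρ̃-cong : ∀ {a b} → _≈ᴬ_ G a b → ρ̃ a ≡ ρ̃ b)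
               (ρ̃-adj : ∀ {a b} → UAdj G a b → E G̃ (ρ̃ a) (ρ̃ b))
               (ρ̃-over : ∀ a → fun f (ρ̃ a) ≡ ρ G a) where

  open WalkEquivalence G
  open LoopDeck G
  open Stabiliser G ρ̃ ρ̃-cong

  extend : ∀ {w x} → Walk′ G v w → E G w x → Arr G v
  extend {x = x} p e = x , p ++ edge G e

  ρ̃-extend-adj : ∀ {w x} (p : Walk′ G v w) (e : E G w x) → E G̃ (ρ̃ (w , p)) (ρ̃ (extend p e))
  ρ̃-extend-adj p e = ρ̃-adj (e , ≈ᴬ-refl G)

  ρ̃-extend-edge : ∀ {w x} (p p′ : Walk′ G v w) → ρ̃ (w , p) ≡ ρ̃ (w , p′) →
                  (e : E G w x) → ρ̃ (extend p e) ≡ ρ̃ (extend p′ e)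
  ρ̃-extend-edge p p′ eq e =
    covering-neighbour-injective f hc (ρ̃-extend-adj p e)
      (subst (λ y → E G̃ y (ρ̃ (extend p′ e))) (sym eq) (ρ̃-extend-adj p′ e))
      (trans (ρ̃-over (extend p e)) (sym (ρ̃-over (extend p′ e))))

  ρ̃-extend : ∀ {w u} (p p′ : Walk′ G v w) → ρ̃ (w , p) ≡ ρ̃ (w , p′) →
             (r : Walk′ G w u) → ρ̃ (u , p ++ r) ≡ ρ̃ (u , p′ ++ r)
  ρ̃-extend {w} p p′ eq [ _ ] =
    subst₂ (λ q q′ → ρ̃ (w , q) ≡ ρ̃ (w , q′)) (sym (++-identityʳ p)) (sym (++-identityʳ p′)) eq
  ρ̃-extend {u = u} p p′ eq (cons _ e r) =
    subst₂ (λ q q′ → ρ̃ (u , q) ≡ ρ̃ (u , q′)) (++-assoc p (edge G e) r) (++-assoc p′ (edge G e) r)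
      (ρ̃-extend (p ++ edge G e) (p′ ++ edge G e) (ρ̃-extend-edge p p′ eq e) r)

  loopDeck-fixes : (c : Walk′ G v v) → ρ̃ (v , c) ≡ ρ̃ (base G v) → Fixes (loopDeck c)
  loopDeck-fixes c eq (_ , r) = ρ̃-extend c [ v ] eq r

  ≡⇒sameOrbit : ∀ a b → ρ̃ a ≡ ρ̃ b → SameOrbit G Fixes a b
  ≡⇒sameOrbit (w , p) (w′ , q) eq = sameTarget targets-≡ p q eq
    where
    targets-≡ : w ≡ w′
    targets-≡ = trans (sym (ρ̃-over (w , p))) (trans (cong (fun f) eq) (ρ̃-over (w′ , q)))

    sameTarget : ∀ {w w′} → w ≡ w′ → (p : Walk′ G v w) (q : Walk′ G v w′) →
                 ρ̃ (w , p) ≡ ρ̃ (w′ , q) → SameOrbit G Fixes (w , p) (w′ , q)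
    sameTarget {w} refl p q eq = loopDeck c , loopDeck-fixes c c-lifts-closed , mk c++p≃q
      where
      open SetoidReasoning (≃-setoid v w)
      c = q ++ reverse p

      c-lifts-closed : ρ̃ (v , c) ≡ ρ̃ (base G v)
      c-lifts-closed = trans (ρ̃-extend q p (sym eq) (reverse p)) (ρ̃-cong (mk (++-reverseʳ p)))

      c++p≃q : c ++ p ≃ q
      c++p≃q = begin
        (q ++ reverse p) ++ p ≡⟨ ++-assoc q (reverse p) p ⟩
        q ++ reverse p ++ p   ≈⟨ ≃-++ˡ q (++-reverseˡ p) ⟩
        q ++ [ w ]            ≡⟨ ++-identityʳ q ⟩
        q                     ∎

  liftEdge : ∀ a {z} → E G̃ (ρ̃ a) z → Σ[ b ∈ Arr G v ] (ρ̃ b ≡ z × UAdj G a b)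
  liftEdge (w , p) {z} e = extend p e′ , ρ̃-lift≡z , e′ , ≈ᴬ-refl G
    where
    e′ : E G w (fun f z)
    e′ = subst (λ t → E G t (fun f z)) (ρ̃-over (w , p)) (hom f e)

    ρ̃-lift≡z : ρ̃ (extend p e′) ≡ z
    ρ̃-lift≡z = covering-neighbour-injective f hc (ρ̃-extend-adj p e′) e (ρ̃-over (extend p e′))

  liftWalk : ∀ {y x} → Walk (E G̃) y x → ∀ a → ρ̃ a ≡ y → Σ[ b ∈ Arr G v ] ρ̃ b ≡ x
  liftWalk [ _ ] a eq = a , eq
  liftWalk (cons _ e w) a refl with liftEdge a e
  ... | b , ρ̃b≡ , _ = liftWalk w b ρ̃b≡

  ρ̃-surjective : ∀ {ṽ} → ρ̃ (base G v) ≡ ṽ → ∀ x → Σ[ a ∈ Arr G v ] ρ̃ a ≡ x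
  ρ̃-surjective {ṽ} ρ̃-base x = liftWalk (connected G̃ ṽ x) (base G v) ρ̃-base

  orbitAdj⇒adj : ∀ a b → OrbitAdj G Fixes a b → E G̃ (ρ̃ a) (ρ̃ b)
  orbitAdj⇒adj a b (a′ , b′ , a~a′ , b~b′ , a′∼b′) =
    subst₂ (E G̃) (sym (sameOrbit⇒≡ a a′ a~a′)) (sym (sameOrbit⇒≡ b b′ b~b′)) (ρ̃-adj a′∼b′)

  adj⇒orbitAdj : ∀ a b → E G̃ (ρ̃ a) (ρ̃ b) → OrbitAdj G Fixes a b
  adj⇒orbitAdj a b e with liftEdge a e
  ... | b′ , ρ̃b′≡ρ̃b , a∼b′ =
    a , b′ , (idᴰ G , proj₁ fixes-isSubgroup , ≈ᴬ-refl G) , ≡⇒sameOrbit b b′ (sym ρ̃b′≡ρ̃b) , a∼b′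

corollary3p34 : (G G̃ : Graph) (f : Morphism G̃ G) → IsHomotopyCovering f →
    (v : V G) (ṽ : V G̃) → fun f ṽ ≡ v →
    (ρ̃ : Arr G v → V G̃) →
    (∀ {a b} → _≈ᴬ_ G a b → ρ̃ a ≡ ρ̃ b) →
    (∀ {a b} → UAdj G a b → E G̃ (ρ̃ a) (ρ̃ b)) →
    (∀ a → fun f (ρ̃ a) ≡ ρ G a) →
    ρ̃ (base G v) ≡ ṽ →
    IsSubgroup G (λ s → ∀ a → ρ̃ (fwd s a) ≡ ρ̃ a)
      × QuotientIso G (λ s → ∀ a → ρ̃ (fwd s a) ≡ ρ̃ a) G̃
corollary3p34 G G̃ f hc v ṽ _ ρ̃ ρ̃-cong ρ̃-adj ρ̃-over ρ̃-base =
  fixes-isSubgroup ,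
  ρ̃ , sameOrbit⇒≡ , ≡⇒sameOrbit , ρ̃-surjective ρ̃-base , orbitAdj⇒adj , adj⇒orbitAdj
  where
  open Stabiliser G ρ̃ ρ̃-cong
  open Lifting G G̃ f hc ρ̃ ρ̃-cong ρ̃-adj ρ̃-over
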